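{- Let $H_1$ and $H_2$ be two bipartite graphs with the same vertex classes $A_1$ and $A_2$, and let $S$ be a forest containing a set $X\subset V(S)\cap A_1$ such that each tree of $S$ contains exactly one vertex of $X$. Suppose $i\in[2]$, $x\in V(S)\cap A_i$ and $y\in A_{3-i}\setminus V(S)$ are such that $(S+xy,X)$ is $(d,m)$-extendable in $(H_1,H_2)$. Then $(S,X)$ is $(d,m)$-extendable in $(H_1,H_2)$.
   Context: For a forest $S$, a set $X\subset V(S)$ with exactly one vertex in each tree of $S$, and an edge $e\in E(S)$, $d(e,X)$ is the length of the shortest path in $S$ from a vertex of $e$ to a vertex of $X$. Given bipartite graphs $H_1,H_2$ with the same vertex classes $A_1,A_2$, and such $S$ with $X\subset V(S)\cap A_1$, let $S_i$ ($i\in[2]$) be the subgraph of $S$ with edge set $\{e\in E(S): d(e,X)\equiv i+1 \pmod 2\}$. Then $(S,X)$ is $(d,m)$-extendable in $(H_1,H_2)$ if: (1) $\Delta(S)\leq d$; (2) $S_i\subset H_i$ for each $i\in[2]$; (3) for each $i\in[2]$ and $U\subset A_i$ with $0<|U|\leq 2m$, $|N_{H_i}(U)\setminus V(S)|\geq d|U|-e_{S_i}(U,A_{3-i})$; (4) for each $i\in[2]$ and $U\subset A_i$ with $|U|\geq m$, $|N_{H_i}(U)|\geq |A_{3-i}|/2$. Here $e_{S_i}(U,A_{3-i})$ is the number of edges of $S_i$ between $U$ and $A_{3-i}$, and $S+xy$ is $S$ with the vertex $y$ and edge $xy$ added. -}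

module Defs where

open import Data.Nat using (ℕ; zero; suc; _+_; _*_; _≤_; _<_; _⊓_; _%_; _≡ᵇ_)
open import Data.Bool using (Bool; true; false; _∧_; _∨_; not; if_then_else_)
open import Data.Fin using (Fin; zero; suc; toℕ; _≟_)
open import Data.List using (List; _∷_; []; _∷ʳ_; length)
open import Data.List.Relation.Unary.Linked using (Linked)
open import Data.List.Relation.Unary.Unique.Propositional using (Unique)
open import Data.Product using (Σ; _×_; ∃)
open import Relation.Nullary using (¬_)
open import Relation.Nullary.Decidable using (⌊_⌋)
open import Relation.Binary.PropositionalEquality using (_≡_; _≢_)
open import Relation.Binary.Construct.Closure.ReflexiveTransitive using (Star)

countF : ∀ {n} → (Fin n → Bool) → ℕ
countF {zero}  f = 0
countF {suc n} f = (if f zero then 1 else 0) + countF (λ k → f (suc k))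

sumF : ∀ {n} → (Fin n → ℕ) → ℕ
sumF {zero}  f = 0
sumF {suc n} f = f zero + sumF (λ k → f (suc k))

anyF : ∀ {n} → (Fin n → Bool) → Bool
anyF {zero}  f = false
anyF {suc n} f = f zero ∨ anyF (λ k → f (suc k))

-- Vertex set: Fin n, partitioned into the classes A₁ , A₂ by a map
-- side : Fin n → Fin 2  (side v ≡ zero  means v ∈ A₁,
--                         side v ≡ suc zero means v ∈ A₂).
-- The index i ∈ [2] is encoded as i : Fin 2 (zero ↦ 1, suc zero ↦ 2).

opp : Fin 2 → Fin 2
opp zero       = suc zero
opp (suc zero) = zero

record IsBipartite {n} (side : Fin n → Fin 2) (H : Fin n → Fin n → Bool) : Set where
  field
    sym    : ∀ u v → H u v ≡ H v u
    across : ∀ u v → H u v ≡ true → side u ≢ side v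

record Graph (n : ℕ) : Set where
  field
    vert : Fin n → Bool
    adj  : Fin n → Fin n → Bool

open Graph public

record IsSimple {n} (S : Graph n) : Set where
  field
    sym     : ∀ u v → adj S u v ≡ adj S v u
    irrefl  : ∀ v → adj S v v ≡ false
    inVertL : ∀ u v → adj S u v ≡ true → vert S u ≡ true

Edge : ∀ {n} → Graph n → Fin n → Fin n → Set
Edge S u v = adj S u v ≡ true

HasCycle : ∀ {n} → Graph n → Set
HasCycle S = Σ _ λ v → Σ (List _) λ rest →
  (2 ≤ length rest) × Unique (v ∷ rest) × Linked (Edge S) ((v ∷ rest) ∷ʳ v)

IsForest : ∀ {n} → Graph n → Set
IsForest S = IsSimple S × ¬ HasCycle S

Connected : ∀ {n} → Graph n → Fin n → Fin n → Set
Connected S = Star (Edge S)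

IsRootSet : ∀ {n} → (Fin n → Fin 2) → Graph n → (Fin n → Bool) → Set
IsRootSet side S X =
  (∀ x → X x ≡ true → (vert S x ≡ true) × (side x ≡ zero)) ×
  (∀ v → vert S v ≡ true → ∃ λ x → (X x ≡ true) × Connected S v x) ×
  (∀ x x′ → X x ≡ true → X x′ ≡ true → Connected S x x′ → x ≡ x′)

reach : ∀ {n} → Graph n → (Fin n → Bool) → ℕ → Fin n → Bool
reach S X zero    v = X v
reach S X (suc k) v = reach S X k v ∨ anyF (λ u → reach S X k u ∧ adj S u v)

-- least k < b with p k (or b if there is none)
firstTrue : ℕ → (ℕ → Bool) → ℕ
firstTrue zero    p = zero
firstTrue (suc b) p = if p zero then zero else suc (firstTrue b (λ k → p (suc k)))

-- d(v,X): length of a shortest path in S from v to X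
-- (all such distances are < n, the number of vertices)
distV : ∀ {n} → Graph n → (Fin n → Bool) → Fin n → ℕ
distV {n} S X v = firstTrue n (λ k → reach S X k v)

distE : ∀ {n} → Graph n → (Fin n → Bool) → Fin n → Fin n → ℕ
distE S X u v = distV S X u ⊓ distV S X v

-- uv ∈ E(S_i)  ⇔  uv ∈ E(S) and d(uv,X) ≡ i+1 (mod 2)
-- (with i encoded in Fin 2: index 1 ↦ even, index 2 ↦ odd, i.e. d % 2 = toℕ i)
adjSi : ∀ {n} → Graph n → (Fin n → Bool) → Fin 2 → Fin n → Fin n → Bool
adjSi S X i u v = adj S u v ∧ (distE S X u v % 2 ≡ᵇ toℕ i)

eqb : ∀ {n} → Fin n → Fin n → Bool
eqb a b = ⌊ a ≟ b ⌋

size : ∀ {n} → (Fin n → Bool) → ℕ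
size U = countF U

SubsetOfClass : ∀ {n} → (Fin n → Fin 2) → Fin 2 → (Fin n → Bool) → Set
SubsetOfClass side i U = ∀ v → U v ≡ true → side v ≡ i

nbhd : ∀ {n} → (Fin n → Fin n → Bool) → (Fin n → Bool) → Fin n → Bool
nbhd H U w = anyF (λ u → U u ∧ H u w)

nbhdOutside : ∀ {n} → (Fin n → Fin n → Bool) → Graph n → (Fin n → Bool) → ℕ
nbhdOutside H S U = countF (λ w → nbhd H U w ∧ not (vert S w))

eSi : ∀ {n} → (Fin n → Fin 2) → Graph n → (Fin n → Bool) → Fin 2 → (Fin n → Bool) → ℕ
eSi side S X i U =
  sumF (λ u → countF (λ w → U u ∧ eqb (side w) (opp i) ∧ adjSi S X i u w))

classSize : ∀ {n} → (Fin n → Fin 2) → Fin 2 → ℕ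
classSize side j = countF (λ v → eqb (side v) j)

MaxDegLe : ∀ {n} → Graph n → ℕ → Set
MaxDegLe S d = ∀ v → countF (adj S v) ≤ d

-- (S , X) is (d , m)-extendable in (H₁ , H₂); H i is H_{i+1} in Fin 2 encoding.

record Extendable {n} (side : Fin n → Fin 2) (H : Fin 2 → Fin n → Fin n → Bool)
                  (d m : ℕ) (S : Graph n) (X : Fin n → Bool) : Set where
  field
    cond1 : MaxDegLe S d
    cond2 : ∀ i u v → adjSi S X i u v ≡ true → H i u v ≡ true
    -- |N(U) \ V(S)| ≥ d|U| - e_{S_i}(U, A_{3-i})   (stated additively in ℕ)
    cond3 : ∀ i U → SubsetOfClass side i U → 0 < size U → size U ≤ 2 * m →
            d * size U ≤ nbhdOutside (H i) S U + eSi side S X i U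
    cond4 : ∀ i U → SubsetOfClass side i U → m ≤ size U →
            classSize side (opp i) ≤ 2 * countF (nbhd (H i) U)

addEdge : ∀ {n} → Graph n → Fin n → Fin n → Graph n
vert (addEdge S x y) w   = vert S w ∨ eqb w y
adj  (addEdge S x y) u v = adj S u v ∨ (eqb u x ∧ eqb v y) ∨ (eqb u y ∧ eqb v x)

-- Deleting the pendant edge xy only removes the leaf y, so every other vertex keeps its
-- distance to X and every edge of S keeps its class S_j; conditions (1), (2) and (4)
-- therefore pass from S + xy to S. In (3) the edge xy adds at most one to
-- e_{S_j}(U, A_{3-j}), and only when x ∈ U and xy ∈ (S + xy)_j ⊆ H_j; but then y is a
-- neighbour of U outside V(S), which compensates. The edge is never counted from the
-- side of y: every edge of S lies in a bipartite H_j, so S is bipartite, d(x,X) has the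
-- parity of the class of x, and xy lies in the class S_j with j the class of x.
module Submission where

open import Defs
open import Data.Nat using (ℕ; zero; suc; _+_; _≤_; _<_; _⊓_; _%_; _≡ᵇ_; z≤n; s≤s)
open import Data.Nat.Properties
  using (≤-trans; ≤-refl; ≤-reflexive; ≤-antisym; ≤-pred; m≤n⇒m≤1+n; n≤1+n; ≮⇒≥; m+1+n≰m;
         +-suc; +-identityʳ; +-comm; +-assoc; +-commutativeSemigroup; m≤n+m; m≥n⇒m⊓n≡n;
         +-mono-≤; +-monoʳ-≤; +-monoˡ-≤; module ≤-Reasoning)
open import Algebra.Properties.CommutativeSemigroup +-commutativeSemigroup using (interchange)
open import Data.Bool using (Bool; true; false; _∧_; _∨_; not; if_then_else_)
open import Data.Bool.Properties using (∧-zeroʳ; ¬-not)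
open import Data.Fin using (Fin; zero; suc; toℕ; _≟_)
open import Data.Fin.Properties using (suc-injective)
open import Data.Product using (_×_; _,_; proj₁; proj₂; ∃)
open import Data.Sum using (_⊎_; inj₁; inj₂)
open import Relation.Nullary using (¬_; yes; no; contradiction)
open import Relation.Nullary.Decidable using (dec-true; dec-false; isYes≗does)
open import Relation.Binary.PropositionalEquality
open import Relation.Binary.Construct.Closure.ReflexiveTransitive using (ε; _◅_)

true≢false : true ≢ false
true≢false ()

∨-true-split : ∀ a {b} → a ∨ b ≡ true → a ≡ true ⊎ b ≡ true
∨-true-split true  _ = inj₁ refl
∨-true-split false p = inj₂ p

∨-true-introˡ : ∀ {a} b → a ≡ true → a ∨ b ≡ true
∨-true-introˡ b refl = refl

∨-true-introʳ : ∀ a {b} → b ≡ true → a ∨ b ≡ true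
∨-true-introʳ true  _ = refl
∨-true-introʳ false p = p

∧-true-split : ∀ a {b} → a ∧ b ≡ true → a ≡ true × b ≡ true
∧-true-split true  p = refl , p
∧-true-split false ()

∧-true-intro : ∀ {a b} → a ≡ true → b ≡ true → a ∧ b ≡ true
∧-true-intro refl refl = refl

not-∨-trueˡ : ∀ a {b} → not (a ∨ b) ≡ true → not a ≡ true
not-∨-trueˡ false _ = refl
not-∨-trueˡ true  ()

not-true⇒false : ∀ {b} → not b ≡ true → b ≡ false
not-true⇒false {false} _ = refl
not-true⇒false {true}  ()

ind : Bool → ℕ
ind b = if b then 1 else 0

ind-mono : ∀ a b → (a ≡ true → b ≡ true) → ind a ≤ ind b
ind-mono false b _ = z≤n
ind-mono true  b h rewrite h refl = ≤-refl

≡ᵇ-refl : ∀ m → (m ≡ᵇ m) ≡ true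
≡ᵇ-refl zero    = refl
≡ᵇ-refl (suc m) = ≡ᵇ-refl m

eqb-sound : ∀ {n} {a b : Fin n} → eqb a b ≡ true → a ≡ b
eqb-sound {a = a} {b} p with a ≟ b
... | yes a≡b = a≡b
eqb-sound () | no _

eqb-pair-sound : ∀ {n} {a b c e : Fin n} → eqb a b ∧ eqb c e ≡ true → a ≡ b × c ≡ e
eqb-pair-sound {a = a} {b} p with ∧-true-split (eqb a b) p
... | a≡b , c≡e = eqb-sound a≡b , eqb-sound c≡e

eqb-refl : ∀ {n} (a : Fin n) → eqb a a ≡ true
eqb-refl a = trans (isYes≗does (a ≟ a)) (dec-true (a ≟ a) refl)

eqb-false : ∀ {n} {a b : Fin n} → a ≢ b → eqb a b ≡ false
eqb-false {a = a} {b} a≢b = trans (isYes≗does (a ≟ b)) (dec-false (a ≟ b) a≢b)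

opp-opp : ∀ j → opp (opp j) ≡ j
opp-opp zero       = refl
opp-opp (suc zero) = refl

≢⇒≡opp : ∀ {a b : Fin 2} → a ≢ b → b ≡ opp a
≢⇒≡opp {zero}     {zero}     a≢b = contradiction refl a≢b
≢⇒≡opp {zero}     {suc zero} _   = refl
≢⇒≡opp {suc zero} {zero}     _   = refl
≢⇒≡opp {suc zero} {suc zero} a≢b = contradiction refl a≢b

toℕ-opp-≢ : ∀ j → (toℕ j ≡ᵇ toℕ (opp j)) ≢ true
toℕ-opp-≢ zero       ()
toℕ-opp-≢ (suc zero) ()

parity : ℕ → Fin 2
parity zero    = zero
parity (suc k) = opp (parity k)

parity-%2 : ∀ m → m % 2 ≡ toℕ (parity m)
parity-%2 zero          = refl
parity-%2 (suc zero)    = refl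
parity-%2 (suc (suc m)) = trans (parity-%2 m) (cong toℕ (sym (opp-opp (parity m))))

anyF-sound : ∀ {n} (f : Fin n → Bool) → anyF f ≡ true → ∃ λ u → f u ≡ true
anyF-sound {suc n} f p with f zero in e
... | true  = zero , e
... | false with anyF-sound (λ k → f (suc k)) p
...   | u , q = suc u , q

anyF-intro : ∀ {n} (f : Fin n → Bool) u → f u ≡ true → anyF f ≡ true
anyF-intro f zero    p rewrite p = refl
anyF-intro f (suc u) p = ∨-true-introʳ (f zero) (anyF-intro (λ k → f (suc k)) u p)

countF-mono : ∀ {n} (f g : Fin n → Bool) → (∀ w → f w ≡ true → g w ≡ true) → countF f ≤ countF g
countF-mono {zero}  f g f⊆g = z≤n
countF-mono {suc n} f g f⊆g =
  +-mono-≤ (ind-mono (f zero) (g zero) (f⊆g zero))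
           (countF-mono (λ k → f (suc k)) (λ k → g (suc k)) (λ w → f⊆g (suc w)))

countF-false : ∀ {n} (f : Fin n → Bool) → (∀ w → f w ≡ false) → countF f ≡ 0
countF-false {zero}  f h = refl
countF-false {suc n} f h rewrite h zero = countF-false (λ k → f (suc k)) (λ w → h (suc w))

countF-true : ∀ n → countF {n} (λ _ → true) ≡ n
countF-true zero    = refl
countF-true (suc n) = cong suc (countF-true n)

1≤countF : ∀ {n} (f : Fin n → Bool) v → f v ≡ true → 1 ≤ countF f
1≤countF f zero    p rewrite p = s≤s z≤n
1≤countF f (suc v) p = ≤-trans (1≤countF (λ k → f (suc k)) v p) (m≤n+m _ _)

countF-insert : ∀ {n} (f g : Fin n → Bool) y → (∀ w → f w ≡ true → g w ≡ true) → f y ≡ false →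
                countF f + ind (g y) ≤ countF g
countF-insert f g zero f⊆g fy rewrite fy | +-comm (countF (λ k → f (suc k))) (ind (g zero)) =
  +-monoʳ-≤ (ind (g zero)) (countF-mono (λ k → f (suc k)) (λ k → g (suc k)) (λ w → f⊆g (suc w)))
countF-insert f g (suc y) f⊆g fy =
  ≤-trans (≤-reflexive (+-assoc (ind (f zero)) (countF (λ k → f (suc k))) (ind (g (suc y)))))
          (+-mono-≤ (ind-mono (f zero) (g zero) (f⊆g zero))
                    (countF-insert (λ k → f (suc k)) (λ k → g (suc k)) y (λ w → f⊆g (suc w)) fy))

countF-full : ∀ {n} (f : Fin n → Bool) → n ≤ countF f → ∀ v → f v ≡ true
countF-full {n} f full v with f v in fv
... | true  = refl
... | false = contradiction (≤-trans inserted (≤-trans (≤-reflexive (countF-true n)) full)) (m+1+n≰m _)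
  where
  inserted : countF f + 1 ≤ countF {n} (λ _ → true)
  inserted = countF-insert f (λ _ → true) v (λ _ _ → refl) fv

countF-∨ : ∀ {n} (f g : Fin n → Bool) → countF (λ w → f w ∨ g w) ≤ countF f + countF g
countF-∨ {zero}  f g = z≤n
countF-∨ {suc n} f g with f zero | g zero
... | true  | true  = s≤s (≤-trans (countF-∨ (λ k → f (suc k)) (λ k → g (suc k)))
                                   (+-monoʳ-≤ (countF (λ k → f (suc k))) (n≤1+n _)))
... | true  | false = s≤s (countF-∨ (λ k → f (suc k)) (λ k → g (suc k)))
... | false | true  = ≤-trans (s≤s (countF-∨ (λ k → f (suc k)) (λ k → g (suc k))))
                              (≤-reflexive (sym (+-suc (countF (λ k → f (suc k))) _)))
... | false | false = countF-∨ (λ k → f (suc k)) (λ k → g (suc k))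

countF-single : ∀ {n} (f : Fin n → Bool) y → (∀ w → w ≢ y → f w ≡ false) → countF f ≤ ind (f y)
countF-single f zero h
  rewrite countF-false (λ k → f (suc k)) (λ w → h (suc w) (λ ())) = ≤-reflexive (+-identityʳ _)
countF-single f (suc y) h rewrite h zero (λ ()) =
  countF-single (λ k → f (suc k)) y (λ w w≢y → h (suc w) (λ e → w≢y (suc-injective e)))

sumF-zero : ∀ {n} (g : Fin n → ℕ) → (∀ u → g u ≡ 0) → sumF g ≡ 0
sumF-zero {zero}  g h = refl
sumF-zero {suc n} g h rewrite h zero = sumF-zero (λ k → g (suc k)) (λ u → h (suc u))

sumF-single : ∀ {n} (g : Fin n → ℕ) x → (∀ u → u ≢ x → g u ≡ 0) → sumF g ≤ g x
sumF-single g zero h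
  rewrite sumF-zero (λ k → g (suc k)) (λ u → h (suc u) (λ ())) = ≤-reflexive (+-identityʳ _)
sumF-single g (suc x) h rewrite h zero (λ ()) =
  sumF-single (λ k → g (suc k)) x (λ u u≢x → h (suc u) (λ e → u≢x (suc-injective e)))

sumF-mono : ∀ {n} (g h : Fin n → ℕ) → (∀ u → g u ≤ h u) → sumF g ≤ sumF h
sumF-mono {zero}  g h g≤h = z≤n
sumF-mono {suc n} g h g≤h =
  +-mono-≤ (g≤h zero) (sumF-mono (λ k → g (suc k)) (λ k → h (suc k)) (λ u → g≤h (suc u)))

sumF-+ : ∀ {n} (g h : Fin n → ℕ) → sumF (λ u → g u + h u) ≡ sumF g + sumF h
sumF-+ {zero}  g h = refl
sumF-+ {suc n} g h =
  trans (cong (g zero + h zero +_) (sumF-+ (λ k → g (suc k)) (λ k → h (suc k))))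
        (interchange (g zero) (h zero) (sumF (λ k → g (suc k))) (sumF (λ k → h (suc k))))

firstTrue-≤ : ∀ b p k → k < b → p k ≡ true → firstTrue b p ≤ k
firstTrue-≤ (suc b) p zero    _        pk rewrite pk = z≤n
firstTrue-≤ (suc b) p (suc k) (s≤s k<b) pk with p zero
... | true  = z≤n
... | false = s≤s (firstTrue-≤ b (λ l → p (suc l)) k k<b pk)

firstTrue-holds : ∀ b p → firstTrue b p < b → p (firstTrue b p) ≡ true
firstTrue-holds (suc b) p lt with p zero in p0
... | true  = p0
... | false = firstTrue-holds b (λ l → p (suc l)) (≤-pred lt)

firstTrue-least : ∀ b p l → l < firstTrue b p → p l ≡ false
firstTrue-least (suc b) p zero lt with p zero
... | false = refl
firstTrue-least (suc b) p (suc l) lt with p zero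
... | false = firstTrue-least b (λ k → p (suc k)) l (≤-pred lt)

firstTrue-anti : ∀ b p q → (∀ k → p k ≡ true → q k ≡ true) → firstTrue b q ≤ firstTrue b p
firstTrue-anti zero    p q p⊆q = z≤n
firstTrue-anti (suc b) p q p⊆q with p zero in p0 | q zero in q0
... | true  | true  = z≤n
... | true  | false = contradiction (trans (sym (p⊆q zero p0)) q0) true≢false
... | false | true  = z≤n
... | false | false = s≤s (firstTrue-anti b (λ k → p (suc k)) (λ k → q (suc k)) (λ k → p⊆q (suc k)))

module _ {n} (G : Graph n) (X : Fin n → Bool) where

  reach-suc : ∀ k v → reach G X k v ≡ true → reach G X (suc k) v ≡ true
  reach-suc k v = ∨-true-introˡ (anyF (λ u → reach G X k u ∧ adj G u v))

  reach-step : ∀ k u v → reach G X k u ≡ true → adj G u v ≡ true → reach G X (suc k) v ≡ true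
  reach-step k u v p a =
    ∨-true-introʳ (reach G X k v) (anyF-intro (λ w → reach G X k w ∧ adj G w v) u (∧-true-intro p a))

  reach-suc-inv : ∀ k v → reach G X (suc k) v ≡ true →
                  reach G X k v ≡ true ⊎ ∃ λ u → reach G X k u ≡ true × adj G u v ≡ true
  reach-suc-inv k v p with ∨-true-split (reach G X k v) p
  ... | inj₁ q = inj₁ q
  ... | inj₂ q with anyF-sound (λ u → reach G X k u ∧ adj G u v) q
  ...   | u , s = inj₂ (u , ∧-true-split (reach G X k u) s)

  X⊆reach : ∀ k v → X v ≡ true → reach G X k v ≡ true
  X⊆reach zero    v p = p
  X⊆reach (suc k) v p = reach-suc k v (X⊆reach k v p)

  Closed : ℕ → Set
  Closed k = ∀ u v → reach G X k u ≡ true → adj G u v ≡ true → reach G X k v ≡ true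

  Closed-suc : ∀ k → Closed k → Closed (suc k)
  Closed-suc k closed u v p a with reach-suc-inv k u p
  ... | inj₁ q           = reach-suc k v (closed u v q a)
  ... | inj₂ (w , q , b) = reach-suc k v (closed u v (closed w u q b) a)

  -- A layer that is not closed under edges gains a vertex at the next step, so with n
  -- vertices layer n - 1 is either everything or closed.
  reach-grows-or-closes : ∀ {x₀} → X x₀ ≡ true → ∀ k → suc k ≤ countF (reach G X k) ⊎ Closed k
  reach-grows-or-closes X₀ zero = inj₁ (1≤countF X _ X₀)
  reach-grows-or-closes X₀ (suc k) with reach-grows-or-closes X₀ k
  ... | inj₂ closed = inj₂ (Closed-suc k closed)
  ... | inj₁ grown with anyF (λ v → reach G X (suc k) v ∧ not (reach G X k v)) in new
  ...   | true  = inj₁ (grows (anyF-sound _ new))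
    where
    open ≤-Reasoning
    grows : (∃ λ v → (reach G X (suc k) v ∧ not (reach G X k v)) ≡ true) →
            suc (suc k) ≤ countF (reach G X (suc k))
    grows (v , fresh) with ∧-true-split (reach G X (suc k) v) fresh
    ... | reached , unreached = begin
      suc (suc k)                                    ≤⟨ s≤s grown ⟩
      suc (countF (reach G X k))                     ≡⟨ +-comm 1 _ ⟩
      countF (reach G X k) + ind true                ≡⟨ cong (λ b → countF (reach G X k) + ind b) (sym reached) ⟩
      countF (reach G X k) + ind (reach G X (suc k) v)
        ≤⟨ countF-insert (reach G X k) (reach G X (suc k)) v (reach-suc k) (not-true⇒false unreached) ⟩
      countF (reach G X (suc k))                     ∎
  ...   | false = inj₂ (Closed-suc k (λ u v p a → stable v (reach-step k u v p a)))
    where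
    stable : ∀ v → reach G X (suc k) v ≡ true → reach G X k v ≡ true
    stable v p = ¬-not λ old →
      true≢false (trans (sym (anyF-intro _ v (∧-true-intro p (cong not old)))) new)

  Closed-connected : (∀ u v → adj G u v ≡ adj G v u) → ∀ k → Closed k →
                     ∀ {u v} → Connected G u v → reach G X k v ≡ true → reach G X k u ≡ true
  Closed-connected adj-sym k closed ε            p = p
  Closed-connected adj-sym k closed (e ◅ path) p =
    closed _ _ (Closed-connected adj-sym k closed path p) (trans (adj-sym _ _) e)

  reach-connected : (∀ u v → adj G u v ≡ adj G v u) → ∀ {x₀ v} → X x₀ ≡ true → Connected G v x₀ →
                    ∀ k → n ≤ suc k → reach G X k v ≡ true
  reach-connected adj-sym {x₀} {v} X₀ path k n≤1+k with reach-grows-or-closes X₀ k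
  ... | inj₁ grown  = countF-full (reach G X k) (≤-trans n≤1+k grown) v
  ... | inj₂ closed = Closed-connected adj-sym k closed path (X⊆reach k x₀ X₀)

distV-connected : ∀ {n} (G : Graph n) X → (∀ u v → adj G u v ≡ adj G v u) →
                  ∀ {x₀ v} → X x₀ ≡ true → Connected G v x₀ → distV G X v < n
distV-connected {zero}  G X adj-sym {v = ()} _ _
distV-connected {suc k} G X adj-sym {v = v} X₀ path =
  s≤s (firstTrue-≤ (suc k) (λ l → reach G X l v) k ≤-refl (reach-connected G X adj-sym X₀ path k ≤-refl))

reach-⊆ : ∀ {n} {G G′ : Graph n} X → (∀ {u w} → adj G u w ≡ true → adj G′ u w ≡ true) →
          ∀ k v → reach G X k v ≡ true → reach G′ X k v ≡ true
reach-⊆ X G⊆G′ zero    v p = p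
reach-⊆ {G = G} {G′} X G⊆G′ (suc k) v p with reach-suc-inv G X k v p
... | inj₁ q           = reach-suc G′ X k v (reach-⊆ X G⊆G′ k v q)
... | inj₂ (u , q , a) = reach-step G′ X k u v (reach-⊆ X G⊆G′ k u q) (G⊆G′ a)

module _ {n} (G : Graph n) (X : Fin n → Bool) (side : Fin n → Fin 2)
         (across : ∀ u w → adj G u w ≡ true → side u ≢ side w)
         (X⊆A₁ : ∀ v → X v ≡ true → side v ≡ zero) where

  reach-parity : ∀ k v → reach G X k v ≡ true →
                 ∃ λ l → l ≤ k × side v ≡ parity l × reach G X l v ≡ true
  reach-parity zero v p = 0 , z≤n , X⊆A₁ v p , p
  reach-parity (suc k) v p with reach-suc-inv G X k v p
  ... | inj₁ q with reach-parity k v q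
  ...   | l , l≤k , sv , r = l , m≤n⇒m≤1+n l≤k , sv , r
  reach-parity (suc k) v p | inj₂ (u , q , a) with reach-parity k u q
  ...   | l , l≤k , su , r =
    suc l , s≤s l≤k , trans (≢⇒≡opp (across u v a)) (cong opp su) , reach-step G X l u v r a

  side-distV : ∀ v → distV G X v < n → side v ≡ parity (distV G X v)
  side-distV v found
    with reach-parity _ v (firstTrue-holds n (λ k → reach G X k v) found)
  ... | l , l≤D , sv , r = subst (λ k → side v ≡ parity k) (≤-antisym l≤D (≮⇒≥ l≮D)) sv
    where
    l≮D : ¬ l < distV G X v
    l≮D l<D = true≢false (trans (sym r) (firstTrue-least n (λ k → reach G X k v) l l<D))

adjSi-bipartite : ∀ {n} (side : Fin n → Fin 2) (H : Fin 2 → Fin n → Fin n → Bool) →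
                  (∀ j → IsBipartite side (H j)) → (G : Graph n) (X : Fin n → Bool) →
                  (∀ j u w → adjSi G X j u w ≡ true → H j u w ≡ true) →
                  ∀ u w → adj G u w ≡ true → side u ≢ side w
adjSi-bipartite side H bip G X Gⱼ⊆Hⱼ u w a = IsBipartite.across (bip j) u w (Gⱼ⊆Hⱼ j u w uw∈Gⱼ)
  where
  j : Fin 2
  j = parity (distE G X u w)
  uw∈Gⱼ : adjSi G X j u w ≡ true
  uw∈Gⱼ = ∧-true-intro a (subst (λ e → (e ≡ᵇ toℕ j) ≡ true) (sym (parity-%2 (distE G X u w))) (≡ᵇ-refl (toℕ j)))

adjSi-transfer : ∀ {n} {G G′ : Graph n} {X j u w} → (adj G u w ≡ true → adj G′ u w ≡ true) →
                 distE G X u w ≡ distE G′ X u w → adjSi G X j u w ≡ true → adjSi G′ X j u w ≡ true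
adjSi-transfer {G = G} {X = X} {j} {u} {w} uw∈G′ same-dist p with ∧-true-split (adj G u w) p
... | uw∈G , in-class =
  ∧-true-intro (uw∈G′ uw∈G) (subst (λ e → (e % 2 ≡ᵇ toℕ j) ≡ true) same-dist in-class)

MaxDegLe-⊆ : ∀ {n} {G G′ : Graph n} {d} → (∀ {u w} → adj G u w ≡ true → adj G′ u w ≡ true) →
             MaxDegLe G′ d → MaxDegLe G d
MaxDegLe-⊆ {G = G} {G′} G⊆G′ Δ≤d v = ≤-trans (countF-mono (adj G v) (adj G′ v) (λ w → G⊆G′)) (Δ≤d v)

adj-⊆-addEdge : ∀ {n} (S : Graph n) x y {u w} → adj S u w ≡ true → adj (addEdge S x y) u w ≡ true
adj-⊆-addEdge S x y {u} {w} = ∨-true-introˡ ((eqb u x ∧ eqb w y) ∨ (eqb u y ∧ eqb w x))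

addEdge-adj-inv : ∀ {n} (S : Graph n) x y u w → adj (addEdge S x y) u w ≡ true →
                  adj S u w ≡ true ⊎ (u ≡ x × w ≡ y) ⊎ (u ≡ y × w ≡ x)
addEdge-adj-inv S x y u w p with ∨-true-split (adj S u w) p
... | inj₁ q = inj₁ q
... | inj₂ q with ∨-true-split (eqb u x ∧ eqb w y) q
...   | inj₁ r = inj₂ (inj₁ (eqb-pair-sound r))
...   | inj₂ r = inj₂ (inj₂ (eqb-pair-sound r))

capacity : ∀ {n} → (Fin n → Fin 2) → (Fin n → Fin n → Bool) → Graph n → (Fin n → Bool) →
           Fin 2 → (Fin n → Bool) → ℕ
capacity side Hj S X j U = nbhdOutside Hj S U + eSi side S X j U

module PendantEdge {n} (S : Graph n) (simple : IsSimple S) (X : Fin n → Bool) (x y : Fin n)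
                   (x∈S : vert S x ≡ true) (y∉S : vert S y ≡ false)
                   (X⊆S : ∀ v → X v ≡ true → vert S v ≡ true) where

  S′ : Graph n
  S′ = addEdge S x y

  ∉S : ∀ {v} → v ≡ y → vert S v ≢ true
  ∉S refl v∈S = true≢false (trans (sym v∈S) y∉S)

  x≢y : x ≢ y
  x≢y x≡y = ∉S x≡y x∈S

  X-y : X y ≡ false
  X-y with X y in Xy
  ... | true  = contradiction (X⊆S y Xy) (∉S refl)
  ... | false = refl

  edge-avoids-y : ∀ {u w} → adj S u w ≡ true → u ≢ y × w ≢ y
  edge-avoids-y {u} {w} a =
    (λ u≡y → ∉S u≡y (IsSimple.inVertL simple u w a)) ,
    (λ w≡y → ∉S w≡y (IsSimple.inVertL simple w u (trans (IsSimple.sym simple w u) a)))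

  reach-addEdge : ∀ k → (∀ w → w ≢ y → reach S′ X k w ≡ true → reach S X k w ≡ true)
                      × (reach S′ X k y ≡ true → reach S X k x ≡ true)
  reach-addEdge zero = (λ _ _ p → p) , (λ p → contradiction (trans (sym p) X-y) true≢false)
  reach-addEdge (suc k) = away-from-y , at-y
    where
    ih = reach-addEdge k
    away-from-y : ∀ w → w ≢ y → reach S′ X (suc k) w ≡ true → reach S X (suc k) w ≡ true
    away-from-y w w≢y p with reach-suc-inv S′ X k w p
    ... | inj₁ q = reach-suc S X k w (proj₁ ih w w≢y q)
    ... | inj₂ (u , q , a) with addEdge-adj-inv S x y u w a
    ...   | inj₁ uw∈S              = reach-step S X k u w (proj₁ ih u (proj₁ (edge-avoids-y uw∈S)) q) uw∈S
    ...   | inj₂ (inj₁ (_ , w≡y))  = contradiction w≡y w≢y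
    ...   | inj₂ (inj₂ (refl , refl)) = reach-suc S X k x (proj₂ ih q)
    at-y : reach S′ X (suc k) y ≡ true → reach S X (suc k) x ≡ true
    at-y p with reach-suc-inv S′ X k y p
    ... | inj₁ q = reach-suc S X k x (proj₂ ih q)
    ... | inj₂ (u , q , a) with addEdge-adj-inv S x y u y a
    ...   | inj₁ uy∈S             = contradiction refl (proj₂ (edge-avoids-y uy∈S))
    ...   | inj₂ (inj₁ (refl , _)) = reach-suc S X k x (proj₁ ih x x≢y q)
    ...   | inj₂ (inj₂ (_ , y≡x))  = contradiction (sym y≡x) x≢y

  reach-⊆-addEdge : ∀ k v → reach S X k v ≡ true → reach S′ X k v ≡ true
  reach-⊆-addEdge = reach-⊆ X (adj-⊆-addEdge S x y)

  distV-addEdge : ∀ w → w ≢ y → distV S′ X w ≡ distV S X w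
  distV-addEdge w w≢y = ≤-antisym
    (firstTrue-anti n (λ k → reach S X k w) (λ k → reach S′ X k w) (λ k → reach-⊆-addEdge k w))
    (firstTrue-anti n (λ k → reach S′ X k w) (λ k → reach S X k w) (λ k → proj₁ (reach-addEdge k) w w≢y))

  distE-addEdge : ∀ {u w} → adj S u w ≡ true → distE S′ X u w ≡ distE S X u w
  distE-addEdge a = cong₂ _⊓_ (distV-addEdge _ (proj₁ (edge-avoids-y a)))
                              (distV-addEdge _ (proj₂ (edge-avoids-y a)))

  distE-newEdge : distE S′ X y x ≡ distV S X x
  distE-newEdge = trans (m≥n⇒m⊓n≡n x-first) (distV-addEdge x x≢y)
    where
    x-first : distV S′ X x ≤ distV S′ X y
    x-first = firstTrue-anti n (λ k → reach S′ X k y) (λ k → reach S′ X k x)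
                (λ k p → reach-⊆-addEdge k x (proj₂ (reach-addEdge k) p))

  adjSi-addEdge : ∀ {j u w} → adjSi S X j u w ≡ true → adjSi S′ X j u w ≡ true
  adjSi-addEdge {u = u} {w} p =
    adjSi-transfer {G = S} {S′} (adj-⊆-addEdge S x y) (sym (distE-addEdge (proj₁ (∧-true-split (adj S u w) p)))) p

  newEdge-class : ∀ (side : Fin n → Fin 2) → side x ≡ parity (distV S X x) → side y ≡ opp (side x) →
                  adjSi S′ X (side y) y x ≢ true
  newEdge-class side x-parity y-side p =
    toℕ-opp-≢ (side x) (subst₂ (λ a b → (a ≡ᵇ toℕ b) ≡ true) D%2 y-side (proj₂ (∧-true-split (adj S′ y x) p)))
    where
    open ≡-Reasoning
    D%2 : distE S′ X y x % 2 ≡ toℕ (side x)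
    D%2 = begin
      distE S′ X y x % 2        ≡⟨ cong (_% 2) distE-newEdge ⟩
      distV S X x % 2           ≡⟨ parity-%2 (distV S X x) ⟩
      toℕ (parity (distV S X x)) ≡⟨ cong toℕ (sym x-parity) ⟩
      toℕ (side x)              ∎

  module _ (side : Fin n → Fin 2) (Hj : Fin n → Fin n → Bool) (j : Fin 2) (U : Fin n → Bool)
           (U⊆Aⱼ : SubsetOfClass side j U)
           (xy∈Hj : adjSi S′ X j x y ≡ true → Hj x y ≡ true)
           (yx∉S′ : adjSi S′ X (side y) y x ≢ true) where

    y-newNbr : Bool
    y-newNbr = nbhd Hj U y ∧ not (vert S y)

    pairs : Graph n → Fin n → Fin n → Bool
    pairs G u w = U u ∧ eqb (side w) (opp j) ∧ adjSi G X j u w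

    newPair : Fin n → Fin n → Bool
    newPair u w = eqb u x ∧ eqb w y ∧ y-newNbr

    -- The pair (y, x) cannot occur: y ∈ U forces j to be the class of y, and xy ∉ S′_{side y}.
    pairs-addEdge : ∀ u w → pairs S′ u w ≡ true → (newPair u w ∨ pairs S u w) ≡ true
    pairs-addEdge u w p with ∧-true-split (U u) p
    ... | Uu , q with ∧-true-split (eqb (side w) (opp j)) q
    ...   | w∈Aopp , uw∈S′ⱼ with addEdge-adj-inv S x y u w (proj₁ (∧-true-split (adj S′ u w) uw∈S′ⱼ))
    ...     | inj₁ uw∈S = ∨-true-introʳ (newPair u w)
                            (∧-true-intro Uu (∧-true-intro w∈Aopp
                              (adjSi-transfer {G = S′} {S} (λ _ → uw∈S) (distE-addEdge uw∈S) uw∈S′ⱼ)))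
    ...     | inj₂ (inj₁ (refl , refl)) = ∨-true-introˡ (pairs S x y)
                                           (∧-true-intro (eqb-refl x) (∧-true-intro (eqb-refl y) y-new))
      where
      y-new : y-newNbr ≡ true
      y-new = ∧-true-intro (anyF-intro (λ v → U v ∧ Hj v y) x (∧-true-intro Uu (xy∈Hj uw∈S′ⱼ)))
                           (cong not y∉S)
    ...     | inj₂ (inj₂ (refl , refl)) =
      contradiction (subst (λ k → adjSi S′ X k y x ≡ true) (sym (U⊆Aⱼ y Uu)) uw∈S′ⱼ) yx∉S′

    newPairs-count : sumF (λ u → countF (newPair u)) ≤ ind y-newNbr
    newPairs-count = begin
      sumF (λ u → countF (newPair u))
        ≤⟨ sumF-single _ x (λ u u≢x → countF-false (newPair u)
             (λ w → cong (_∧ (eqb w y ∧ y-newNbr)) (eqb-false u≢x))) ⟩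
      countF (newPair x)
        ≤⟨ countF-single (newPair x) y (λ w w≢y → trans
             (cong (λ b → eqb x x ∧ (b ∧ y-newNbr)) (eqb-false w≢y)) (∧-zeroʳ (eqb x x))) ⟩
      ind (newPair x y)
        ≡⟨ cong₂ (λ a b → ind (a ∧ (b ∧ y-newNbr))) (eqb-refl x) (eqb-refl y) ⟩
      ind y-newNbr ∎
      where open ≤-Reasoning

    eSi-addEdge : eSi side S′ X j U ≤ ind y-newNbr + eSi side S X j U
    eSi-addEdge = begin
      eSi side S′ X j U
        ≤⟨ sumF-mono _ _ (λ u → ≤-trans (countF-mono (pairs S′ u) _ (pairs-addEdge u))
                                        (countF-∨ (newPair u) (pairs S u))) ⟩
      sumF (λ u → countF (newPair u) + countF (pairs S u))
        ≡⟨ sumF-+ (λ u → countF (newPair u)) (λ u → countF (pairs S u)) ⟩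
      sumF (λ u → countF (newPair u)) + eSi side S X j U
        ≤⟨ +-monoˡ-≤ (eSi side S X j U) newPairs-count ⟩
      ind y-newNbr + eSi side S X j U ∎
      where open ≤-Reasoning

    nbhdOutside-addEdge : nbhdOutside Hj S′ U + ind y-newNbr ≤ nbhdOutside Hj S U
    nbhdOutside-addEdge =
      countF-insert (λ w → nbhd Hj U w ∧ not (vert S′ w)) (λ w → nbhd Hj U w ∧ not (vert S w)) y
        (λ w p → let nw , outside = ∧-true-split (nbhd Hj U w) p
                 in ∧-true-intro nw (not-∨-trueˡ (vert S w) outside))
        (trans (cong (λ b → nbhd Hj U y ∧ not b) (∨-true-introʳ (vert S y) (eqb-refl y)))
               (∧-zeroʳ (nbhd Hj U y)))

    capacity-addEdge : capacity side Hj S′ X j U ≤ capacity side Hj S X j U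
    capacity-addEdge = begin
      nbhdOutside Hj S′ U + eSi side S′ X j U
        ≤⟨ +-monoʳ-≤ (nbhdOutside Hj S′ U) eSi-addEdge ⟩
      nbhdOutside Hj S′ U + (ind y-newNbr + eSi side S X j U)
        ≡⟨ sym (+-assoc (nbhdOutside Hj S′ U) (ind y-newNbr) (eSi side S X j U)) ⟩
      nbhdOutside Hj S′ U + ind y-newNbr + eSi side S X j U
        ≤⟨ +-monoˡ-≤ (eSi side S X j U) nbhdOutside-addEdge ⟩
      nbhdOutside Hj S U + eSi side S X j U ∎
      where open ≤-Reasoning

proposition4p5 :
    (n : ℕ) (side : Fin n → Fin 2) (H : Fin 2 → Fin n → Fin n → Bool) →
    (∀ j → IsBipartite side (H j)) →
    (S : Graph n) → IsForest S →
    (X : Fin n → Bool) → IsRootSet side S X →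
    (d m : ℕ) (i : Fin 2) (x y : Fin n) →
    vert S x ≡ true → side x ≡ i →
    vert S y ≡ false → side y ≡ opp i →
    Extendable side H d m (addEdge S x y) X →
    Extendable side H d m S X
proposition4p5 n side H bip S (simple , _) X (X-roots , X-covers , _) d m i x y x∈S sx y∉S sy E′ = record
  { cond1 = MaxDegLe-⊆ {G = S} {S′} (adj-⊆-addEdge S x y) (cond1 E′)
  ; cond2 = λ j u w p → cond2 E′ j u w (adjSi-addEdge p)
  ; cond3 = λ j U U⊆Aⱼ U≢∅ small →
      ≤-trans (cond3 E′ j U U⊆Aⱼ U≢∅ small) (capacity-addEdge side (H j) j U U⊆Aⱼ (cond2 E′ j x y) yx∉S′)
  ; cond4 = cond4 E′
  }
  where
  open Extendable
  open PendantEdge S simple X x y x∈S y∉S (λ v p → proj₁ (X-roots v p))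

  S-bipartite : ∀ u w → adj S u w ≡ true → side u ≢ side w
  S-bipartite u w a = adjSi-bipartite side H bip S′ X (cond2 E′) u w (adj-⊆-addEdge S x y a)

  x-parity : side x ≡ parity (distV S X x)
  x-parity with X-covers x x∈S
  ... | x₀ , X₀ , path = side-distV S X side S-bipartite (λ v p → proj₂ (X-roots v p)) x
                           (distV-connected S X (IsSimple.sym simple) X₀ path)

  yx∉S′ : adjSi S′ X (side y) y x ≢ true
  yx∉S′ = newEdge-class side x-parity (trans sy (cong opp (sym sx)))
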